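{- Let $d>6$ and let $G$ be a finite simple $d$-regular graph such that $G^2$ is not complete. Let $X$ be the set of vertices $x$ with $\deg_2(x)<4$, and let $R$ be a region containing a vertex $v\in X$. Then: (1) $R$ contains at least $d+1$ vertices; (2) $R\subseteq \{v\}\cup N(v)\cup N_2(v)$; (3) with $t:=\min\{\deg_2(x): x\in R\}$, $R$ contains at most $d+t+1$ vertices; (4) $R$ contains at most $d+4$ vertices; (5) $R$ is disjoint from every other region $R'\neq R$.
   Context: $G^2$ is the graph on $V(G)$ joining vertices at distance at most 2 in $G$. $N_i(x)$ is the set of vertices at distance exactly $i$ from $x$, $N(x)=N_1(x)$, $\deg_2(x)=|N_2(x)|$. On $X=\{x:\deg_2(x)<4\}$ define $u\sim w$ iff there is a sequence $u=v_0,v_1,\dots,v_t=w$ of vertices of $X$ with $d(v_i,v_{i+1})\le 2$ for all $i$. A region is an equivalence class $X'\subseteq X$ of $\sim$ together with all neighbors of vertices of $X'$. -}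

module Defs where

open import Data.Nat using (ℕ; zero; suc; _+_; _<_)
open import Data.Fin using (Fin; _≟_)
open import Data.Bool using (Bool; true; false; _∧_; _∨_; not; if_then_else_)
open import Data.List using (List; allFin; map)
open import Data.Nat.ListAction using (sum)
open import Data.Bool.ListAction using (any)
open import Data.Product using (Σ; _×_)
open import Data.Sum using (_⊎_)
open import Relation.Binary.PropositionalEquality using (_≡_)
open import Relation.Nullary.Decidable using (⌊_⌋)

record Graph (n : ℕ) : Set where
  field
    adj   : Fin n → Fin n → Bool
    sym   : ∀ x y → adj x y ≡ adj y x
    irrfl : ∀ x → adj x x ≡ false
open Graph public

count : ∀ {n} → (Fin n → Bool) → ℕ
count {n} p = sum (map (λ y → if p y then 1 else 0) (allFin n))

module _ {n : ℕ} (G : Graph n) where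

  -- within k x y = true  iff  d(x,y) ≤ k  (walk of length ≤ k)
  within : ℕ → Fin n → Fin n → Bool
  within zero    x y = ⌊ x ≟ y ⌋
  within (suc k) x y = within k x y ∨ any (λ z → within k x z ∧ adj G z y) (allFin n)

  deg : Fin n → ℕ
  deg x = count (adj G x)

  inN2 : Fin n → Fin n → Bool
  inN2 x y = within 2 x y ∧ not (within 1 x y)

  deg2 : Fin n → ℕ
  deg2 x = count (inN2 x)

  Regular : ℕ → Set
  Regular d = ∀ x → deg x ≡ d

  SquareComplete : Set
  SquareComplete = ∀ x y → within 2 x y ≡ true

  InX : Fin n → Set
  InX x = deg2 x < 4

  data _∼_ : Fin n → Fin n → Set where
    here : ∀ {u} → InX u → u ∼ u
    step : ∀ {u v w} → InX u → within 2 u v ≡ true → v ∼ w → u ∼ w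

  -- The region of the ∼-class of u (u ∈ X): the class plus all neighbours.
  InRegion : Fin n → Fin n → Set
  InRegion u y = Σ (Fin n) (λ w → (u ∼ w) × ((w ≡ y) ⊎ (adj G w y ≡ true)))

-- Two vertices v, w of X at distance ≤ 2 are "locked together": every neighbour t of w
-- is within distance 2 of v. Otherwise, with m a common neighbour of v and w, the
-- closed neighbourhood N[t] (d + 1 vertices) and N[m] ∩ N[v] (at least d + 1 − 3
-- vertices, since N[m] ⊆ N[v] ∪ N₂(v)) would be disjoint subsets of the ball of
-- radius 2 around w, which has at most d + 1 + 3 vertices; this forces d ≤ 5.
-- The same count shows that distance ≤ 2 is transitive on X (two disjoint closed
-- neighbourhoods do not fit in that ball), so each ∼-class has diameter ≤ 2, and
-- then its region lies in the ball of radius 2 around each of its X-vertices.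
-- The size bounds follow from |N[x]| = d + 1 and |B₂(x)| ≤ d + 1 + deg₂(x), and
-- regions meeting in a vertex y come from ∼-classes joined through y.
module Submission where

open import Algebra.Properties.CommutativeSemigroup using (interchange)
open import Data.Bool using (Bool; true; false; _∧_; _∨_; not; if_then_else_; T?)
open import Data.Bool.ListAction using (any)
open import Data.Bool.Properties using (T-≡; ∨-zeroʳ)
open import Data.Empty using (⊥; ⊥-elim)
open import Data.Fin using (Fin; _≟_)
open import Data.List using (List; []; _∷_; _++_; length; map; allFin; filterᵇ)
open import Data.List.Membership.Propositional using (_∈_; lose)
open import Data.List.Membership.Propositional.Properties
  using (∈-allFin; ∈-filter⁺; ∈-∃++; ∈-++⁻; ∈-++⁺ˡ; ∈-++⁺ʳ)
open import Data.List.Properties using (length-++-sucʳ)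
open import Data.List.Relation.Binary.Subset.Propositional using (_⊆_)
open import Data.List.Relation.Unary.All using (All)
import Data.List.Relation.Unary.All as All
open import Data.List.Relation.Unary.All.Properties using (all-filter)
open import Data.List.Relation.Unary.AllPairs using ([]; _∷_)
open import Data.List.Relation.Unary.Any using (here; there; satisfied)
open import Data.List.Relation.Unary.Any.Properties using (any⁺; any⁻)
open import Data.List.Relation.Unary.Unique.Propositional using (Unique)
open import Data.List.Relation.Unary.Unique.Propositional.Properties using (allFin⁺; filter⁺)
open import Data.Nat using (ℕ; zero; suc; _+_; _<_; _≤_; z≤n; s≤s; _<?_)
open import Data.Nat.ListAction using (sum)
open import Data.Nat.Properties
  using (≤-trans; ≤-reflexive; ≤-antisym; ≤-pred; +-comm; +-assoc; +-suc; +-mono-≤; +-monoʳ-≤;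
         +-cancelˡ-≤; m≤m+n; <⇒≤; ≤⇒≯; ≮⇒≥; +-commutativeSemigroup; module ≤-Reasoning)
open import Data.Product using (Σ; _×_; _,_; proj₁; proj₂; ∃-syntax)
open import Data.Sum using (_⊎_; inj₁; inj₂)
open import Defs
open import Function using (_∘_)
open import Function.Bundles using (_⇔_; mk⇔; Equivalence)
open import Relation.Binary.PropositionalEquality using (_≡_; refl; cong)
import Relation.Binary.PropositionalEquality as ≡
open import Relation.Nullary using (¬_; yes; no; contradiction)
open import Relation.Nullary.Decidable using (⌊_⌋; isYes≗does; dec-true)

∨-≡-true⁻ : ∀ a {b} → a ∨ b ≡ true → a ≡ true ⊎ b ≡ true
∨-≡-true⁻ true  _ = inj₁ refl
∨-≡-true⁻ false e = inj₂ e

∧-≡-true⁻ : ∀ a {b} → a ∧ b ≡ true → a ≡ true × b ≡ true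
∧-≡-true⁻ true e = refl , e

≡true⇒⊎∧not : ∀ a b → a ≡ true → b ≡ true ⊎ a ∧ not b ≡ true
≡true⇒⊎∧not true true  _ = inj₁ refl
≡true⇒⊎∧not true false _ = inj₂ refl

≟-sound : ∀ {n} {x y : Fin n} → ⌊ x ≟ y ⌋ ≡ true → x ≡ y
≟-sound {x = x} {y} e with x ≟ y
... | yes x≡y = x≡y

𝟙 : Bool → ℕ
𝟙 b = if b then 1 else 0

module _ {A : Set} {f g : A → ℕ} where

  sum-map-mono : (∀ x → f x ≤ g x) → ∀ xs → sum (map f xs) ≤ sum (map g xs)
  sum-map-mono f≤g []       = z≤n
  sum-map-mono f≤g (x ∷ xs) = +-mono-≤ (f≤g x) (sum-map-mono f≤g xs)

  sum-map-+ : ∀ xs → sum (map (λ x → f x + g x) xs) ≡ sum (map f xs) + sum (map g xs)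
  sum-map-+ []       = refl
  sum-map-+ (x ∷ xs) rewrite sum-map-+ xs = interchange +-commutativeSemigroup (f x) (g x) _ _

𝟙-≤-+ : ∀ {a b c} → (a ≡ true → b ≡ true ⊎ c ≡ true) → 𝟙 a ≤ 𝟙 b + 𝟙 c
𝟙-≤-+ {false}                _ = z≤n
𝟙-≤-+ {true} {true}          _ = s≤s z≤n
𝟙-≤-+ {true} {false} {true}  _ = s≤s z≤n
𝟙-≤-+ {true} {false} {false} a⇒b∨c with a⇒b∨c refl
... | inj₁ ()
... | inj₂ ()

𝟙-+-≤ : ∀ {a b c} → (b ≡ true → c ≡ true → ⊥) → (b ≡ true → a ≡ true) → (c ≡ true → a ≡ true) →
        𝟙 b + 𝟙 c ≤ 𝟙 a
𝟙-+-≤ {_}     {false} {false} _    _   _   = z≤n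
𝟙-+-≤ {_}     {true}  {true}  b∩c  _   _   = ⊥-elim (b∩c refl refl)
𝟙-+-≤ {true}  {true}  {false} _    _   _   = s≤s z≤n
𝟙-+-≤ {true}  {false} {true}  _    _   _   = s≤s z≤n
𝟙-+-≤ {false} {true}  {false} _    b⇒a _   with () ← b⇒a refl
𝟙-+-≤ {false} {false} {true}  _    _   c⇒a with () ← c⇒a refl

module _ {A : Set} where

  countIn : (A → Bool) → List A → ℕ
  countIn p xs = sum (map (λ y → 𝟙 (p y)) xs)

  length-filterᵇ : ∀ (p : A → Bool) xs → length (filterᵇ p xs) ≡ countIn p xs
  length-filterᵇ p []       = refl
  length-filterᵇ p (x ∷ xs) with p x
  ... | true  = cong suc (length-filterᵇ p xs)
  ... | false = length-filterᵇ p xs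

  Unique⇒length≤ : ∀ {xs ys : List A} → Unique xs → xs ⊆ ys → length xs ≤ length ys
  Unique⇒length≤ {[]}     _             _   = z≤n
  Unique⇒length≤ {x ∷ xs} (x∉xs ∷ uniq) sub with as , bs , refl ← ∈-∃++ (sub (here refl)) =
    ≤-trans (s≤s (Unique⇒length≤ uniq xs⊆as++bs)) (≤-reflexive (≡.sym (length-++-sucʳ as x bs)))
    where
    xs⊆as++bs : xs ⊆ as ++ bs
    xs⊆as++bs {z} z∈xs with ∈-++⁻ as (sub (there z∈xs))
    ... | inj₁ z∈as         = ∈-++⁺ˡ z∈as
    ... | inj₂ (here z≡x)   = contradiction (≡.sym z≡x) (All.lookup x∉xs z∈xs)
    ... | inj₂ (there z∈bs) = ∈-++⁺ʳ as z∈bs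

module _ {n : ℕ} where

  count-∪ : ∀ {p q r : Fin n → Bool} → (∀ y → r y ≡ true → p y ≡ true ⊎ q y ≡ true) →
            count r ≤ count p + count q
  count-∪ {p} {q} {r} r⇒p∨q = begin
    count r
      ≤⟨ sum-map-mono (λ y → 𝟙-≤-+ (r⇒p∨q y)) (allFin n) ⟩
    sum (map (λ y → 𝟙 (p y) + 𝟙 (q y)) (allFin n))
      ≡⟨ sum-map-+ {f = 𝟙 ∘ p} {g = 𝟙 ∘ q} (allFin n) ⟩
    count p + count q
      ∎
    where open ≤-Reasoning

  count-disjoint-∪ : ∀ {p q r : Fin n → Bool} → (∀ y → p y ≡ true → q y ≡ true → ⊥) →
                     (∀ y → p y ≡ true → r y ≡ true) → (∀ y → q y ≡ true → r y ≡ true) →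
                     count p + count q ≤ count r
  count-disjoint-∪ {p} {q} {r} p∩q p⇒r q⇒r = begin
    count p + count q
      ≡⟨ sum-map-+ {f = 𝟙 ∘ p} {g = 𝟙 ∘ q} (allFin n) ⟨
    sum (map (λ y → 𝟙 (p y) + 𝟙 (q y)) (allFin n))
      ≤⟨ sum-map-mono (λ y → 𝟙-+-≤ (p∩q y) (p⇒r y) (q⇒r y)) (allFin n) ⟩
    count r
      ∎
    where open ≤-Reasoning

  count-≟ : ∀ (x : Fin n) → count (λ y → ⌊ x ≟ y ⌋) ≡ 1
  count-≟ x = unique-occurrence (allFin n) (allFin⁺ n) (∈-allFin x)
    where
    no-occurrence : ∀ ys → All (λ y → ¬ x ≡ y) ys → countIn (λ y → ⌊ x ≟ y ⌋) ys ≡ 0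
    no-occurrence []       All.[]             = refl
    no-occurrence (y ∷ ys) (x≢y All.∷ x∉ys) with x ≟ y
    ... | yes x≡y = contradiction x≡y x≢y
    ... | no  _   = no-occurrence ys x∉ys

    unique-occurrence : ∀ ys → Unique ys → x ∈ ys → countIn (λ y → ⌊ x ≟ y ⌋) ys ≡ 1
    unique-occurrence (y ∷ ys) (y∉ys ∷ uniq) x∈y∷ys with x ≟ y | x∈y∷ys
    ... | yes refl | _          = cong suc (no-occurrence ys y∉ys)
    ... | no  x≢y  | here x≡y   = contradiction x≡y x≢y
    ... | no  _    | there x∈ys = unique-occurrence ys uniq x∈ys

  Unique⇒length≤count : ∀ {p : Fin n → Bool} {ys} → Unique ys → All (λ y → p y ≡ true) ys →
                        length ys ≤ count p
  Unique⇒length≤count {p} {ys} uniq ps = begin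
    length ys                      ≤⟨ Unique⇒length≤ uniq ys⊆filter ⟩
    length (filterᵇ p (allFin n))  ≡⟨ length-filterᵇ p (allFin n) ⟩
    count p                        ∎
    where
    open ≤-Reasoning
    ys⊆filter : ys ⊆ filterᵇ p (allFin n)
    ys⊆filter {y} y∈ys = ∈-filter⁺ (T? ∘ p) (∈-allFin y) (Equivalence.from T-≡ (All.lookup ps y∈ys))

  count-witness : ∀ (p : Fin n → Bool) → Σ (List (Fin n)) λ ys →
                  Unique ys × All (λ y → p y ≡ true) ys × length ys ≡ count p
  count-witness p = filterᵇ p (allFin n)
                  , filter⁺ (T? ∘ p) (allFin⁺ n)
                  , All.map (Equivalence.to T-≡) (all-filter (T? ∘ p) (allFin n))
                  , length-filterᵇ p (allFin n)

module _ {n : ℕ} (G : Graph n) where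

  Near : Fin n → Fin n → Set
  Near x y = x ≡ y ⊎ adj G x y ≡ true

  near-sym : ∀ {x y} → Near x y → Near y x
  near-sym (inj₁ refl) = inj₁ refl
  near-sym {x} {y} (inj₂ xy) = inj₂ (≡.trans (Graph.sym G y x) xy)

  within-refl : ∀ k x → within G k x x ≡ true
  within-refl zero    x = ≡.trans (isYes≗does (x ≟ x)) (dec-true (x ≟ x) refl)
  within-refl (suc k) x rewrite within-refl k x = refl

  within-suc⁻ : ∀ k {x y} → within G (suc k) x y ≡ true → ∃[ z ] within G k x z ≡ true × Near z y
  within-suc⁻ k {x} {y} xy with ∨-≡-true⁻ (within G k x y) xy
  ... | inj₁ xy′ = y , xy′ , inj₁ refl
  ... | inj₂ viaNeighbour
    with z , xz∧zy ← satisfied (any⁻ _ (allFin n) (Equivalence.from T-≡ viaNeighbour))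
    with xz , zy ← ∧-≡-true⁻ (within G k x z) (Equivalence.to T-≡ xz∧zy)
    = z , xz , inj₂ zy

  within-suc⁺ : ∀ k {x z y} → within G k x z ≡ true → Near z y → within G (suc k) x y ≡ true
  within-suc⁺ k xz (inj₁ refl) rewrite xz = refl
  within-suc⁺ k {x} {z} {y} xz (inj₂ zy) =
    ≡.trans (cong (within G k x y ∨_) viaNeighbour) (∨-zeroʳ _)
    where
    viaNeighbour : any (λ w → within G k x w ∧ adj G w y) (allFin n) ≡ true
    viaNeighbour = Equivalence.to T-≡
      (any⁺ _ (lose (∈-allFin z) (Equivalence.from T-≡ (≡.cong₂ _∧_ xz zy))))

  within₁⁻ : ∀ {x y} → within G 1 x y ≡ true → Near x y
  within₁⁻ xy with z , xz , zy ← within-suc⁻ 0 xy with refl ← ≟-sound xz = zy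

  within₁⁺ : ∀ {x y} → Near x y → within G 1 x y ≡ true
  within₁⁺ = within-suc⁺ 0 (within-refl 0 _)

  within₂⁻ : ∀ {x y} → within G 2 x y ≡ true → ∃[ m ] Near x m × Near m y
  within₂⁻ xy with m , xm , my ← within-suc⁻ 1 xy = m , within₁⁻ xm , my

  within₂⁺ : ∀ {x m y} → Near x m → Near m y → within G 2 x y ≡ true
  within₂⁺ xm = within-suc⁺ 1 (within₁⁺ xm)

  within₂-sym : ∀ {x y} → within G 2 x y ≡ true → within G 2 y x ≡ true
  within₂-sym xy with m , xm , my ← within₂⁻ xy = within₂⁺ (near-sym my) (near-sym xm)

  ∼-endpoints : ∀ {u w} → _∼_ G u w → InX G u × InX G w
  ∼-endpoints (here Xu)      = Xu , Xu
  ∼-endpoints (step Xu _ vw) = Xu , proj₂ (∼-endpoints vw)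

  ∼-trans : ∀ {u v w} → _∼_ G u v → _∼_ G v w → _∼_ G u w
  ∼-trans (here _)          vw = vw
  ∼-trans (step Xu uv′ v′v) vw = step Xu uv′ (∼-trans v′v vw)

  ∼-sym : ∀ {u w} → _∼_ G u w → _∼_ G w u
  ∼-sym (here Xu)       = here Xu
  ∼-sym (step Xu uv vw) =
    ∼-trans (∼-sym vw) (step (proj₁ (∼-endpoints vw)) (within₂-sym uv) (here Xu))

  regions-meet⇒∼ : ∀ {u u′ y} → InRegion G u y → InRegion G u′ y → _∼_ G u u′
  regions-meet⇒∼ (w , u∼w , wy) (_ , u′∼w′ , w′y) with _ , Xw ← ∼-endpoints u∼w =
    ∼-trans u∼w (step Xw (within₂⁺ wy (near-sym w′y)) (∼-sym u′∼w′))

  ∼⇒same-region : ∀ {u u′} → _∼_ G u u′ → ∀ y → InRegion G u y ⇔ InRegion G u′ y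
  ∼⇒same-region u∼u′ y = mk⇔ (λ (w , u∼w , wy) → w , ∼-trans (∼-sym u∼u′) u∼w , wy)
                             (λ (w , u′∼w , wy) → w , ∼-trans u∼u′ u′∼w , wy)

  regions-disjoint : ∀ {u u′} → ¬ (∀ y → InRegion G u y ⇔ InRegion G u′ y) →
                     ∀ y → ¬ (InRegion G u y × InRegion G u′ y)
  regions-disjoint R≢R′ y (uy , u′y) = R≢R′ (∼⇒same-region (regions-meet⇒∼ uy u′y))

module RegularGraph {n : ℕ} (G : Graph n) {d : ℕ} (regular : Regular G d) where

  N[_] : Fin n → Fin n → Bool
  N[ x ] = within G 1 x

  B₂[_] : Fin n → Fin n → Bool
  B₂[ x ] = within G 2 x

  closedNbhd-size : ∀ x → count N[ x ] ≡ suc d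
  closedNbhd-size x = begin
    count N[ x ]                              ≡⟨ ≤-antisym (count-∪ N⇒≡∨adj)
                                                           (count-disjoint-∪ ≡∩adj ≡⇒N adj⇒N) ⟩
    count (λ y → ⌊ x ≟ y ⌋) + count (adj G x) ≡⟨ ≡.cong₂ _+_ (count-≟ x) (regular x) ⟩
    suc d                                     ∎
    where
    open ≡.≡-Reasoning
    N⇒≡∨adj : ∀ y → N[ x ] y ≡ true → ⌊ x ≟ y ⌋ ≡ true ⊎ adj G x y ≡ true
    N⇒≡∨adj y xy with within₁⁻ G xy
    ... | inj₁ refl = inj₁ (within-refl G 0 x)
    ... | inj₂ adj  = inj₂ adj
    ≡∩adj : ∀ y → ⌊ x ≟ y ⌋ ≡ true → adj G x y ≡ true → ⊥
    ≡∩adj y x≡y xy with refl ← ≟-sound x≡y with () ← ≡.trans (≡.sym xy) (irrfl G x)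
    ≡⇒N : ∀ y → ⌊ x ≟ y ⌋ ≡ true → N[ x ] y ≡ true
    ≡⇒N y x≡y = within₁⁺ G (inj₁ (≟-sound x≡y))
    adj⇒N : ∀ y → adj G x y ≡ true → N[ x ] y ≡ true
    adj⇒N y xy = within₁⁺ G (inj₂ xy)

  ball₂-size : ∀ x → count B₂[ x ] ≤ suc d + deg2 G x
  ball₂-size x = ≤-trans (count-∪ (λ y → ≡true⇒⊎∧not (B₂[ x ] y) (N[ x ] y)))
                         (≤-reflexive (cong (_+ deg2 G x) (closedNbhd-size x)))

  deg₂-bound-X : ∀ {x} → InX G x → suc d + deg2 G x ≤ d + 4
  deg₂-bound-X Xx = ≤-trans (+-monoʳ-≤ (suc d) (≤-pred Xx)) (≤-reflexive (≡.sym (+-suc d 3)))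

  ball₂-size-X : ∀ {x} → InX G x → count B₂[ x ] ≤ d + 4
  ball₂-size-X {x} Xx = ≤-trans (ball₂-size x) (deg₂-bound-X {x} Xx)

  module _ (6≤d : 6 ≤ d) where

    B₂-absorbs-N : ∀ {v w t} → InX G v → InX G w → B₂[ v ] w ≡ true → N[ w ] t ≡ true →
                   B₂[ v ] t ≡ true
    B₂-absorbs-N {v} {w} {t} Xv Xw vw wt with B₂[ v ] t in vt
    ... | true  = refl
    ... | false with m , vm , mw ← within₂⁻ G vw =
      contradiction (+-cancelˡ-≤ (suc d) (suc d) 6 counting) (≤⇒≯ 6≤d)
      where
      N[m]∩N[v] : Fin n → Bool
      N[m]∩N[v] y = N[ m ] y ∧ N[ v ] y

      N[m]⊆N[v]∪N₂[v] : ∀ y → N[ m ] y ≡ true → N[m]∩N[v] y ≡ true ⊎ inN2 G v y ≡ true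
      N[m]⊆N[v]∪N₂[v] y my with ≡true⇒⊎∧not _ (N[ v ] y) (within₂⁺ G vm (within₁⁻ G my))
      ... | inj₁ vy  = inj₁ (≡.cong₂ _∧_ my vy)
      ... | inj₂ vy₂ = inj₂ vy₂

      N[t]∩N[m]∩N[v]=∅ : ∀ y → N[ t ] y ≡ true → N[m]∩N[v] y ≡ true → ⊥
      N[t]∩N[m]∩N[v]=∅ y ty mvy with () ← ≡.trans (≡.sym vt)
        (within₂⁺ G (within₁⁻ G (proj₂ (∧-≡-true⁻ _ mvy))) (near-sym G (within₁⁻ G ty)))

      N[t]⊆B₂[w] : ∀ y → N[ t ] y ≡ true → B₂[ w ] y ≡ true
      N[t]⊆B₂[w] y ty = within₂⁺ G (within₁⁻ G wt) (within₁⁻ G ty)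

      N[m]∩N[v]⊆B₂[w] : ∀ y → N[m]∩N[v] y ≡ true → B₂[ w ] y ≡ true
      N[m]∩N[v]⊆B₂[w] y mvy = within₂⁺ G (near-sym G mw) (within₁⁻ G (proj₁ (∧-≡-true⁻ _ mvy)))

      disjoint-in-B₂[w] : count N[ t ] + count N[m]∩N[v] ≤ d + 4
      disjoint-in-B₂[w] =
        ≤-trans (count-disjoint-∪ N[t]∩N[m]∩N[v]=∅ N[t]⊆B₂[w] N[m]∩N[v]⊆B₂[w]) (ball₂-size-X Xw)

      counting : suc d + suc d ≤ suc d + 6
      counting = begin
        suc d + suc d
          ≡⟨ ≡.cong₂ _+_ (closedNbhd-size t) (closedNbhd-size m) ⟨
        count N[ t ] + count N[ m ]
          ≤⟨ +-monoʳ-≤ (count N[ t ]) (count-∪ N[m]⊆N[v]∪N₂[v]) ⟩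
        count N[ t ] + (count N[m]∩N[v] + deg2 G v)
          ≡⟨ +-assoc (count N[ t ]) (count N[m]∩N[v]) (deg2 G v) ⟨
        count N[ t ] + count N[m]∩N[v] + deg2 G v
          ≤⟨ +-mono-≤ disjoint-in-B₂[w] (≤-pred Xv) ⟩
        d + 4 + 3
          ≡⟨ +-assoc d 4 3 ⟩
        d + 7
          ≡⟨ +-suc d 6 ⟩
        suc d + 6
          ∎
        where open ≤-Reasoning

    B₂-trans-X : ∀ {v w w′} → InX G v → InX G w → InX G w′ →
                 B₂[ v ] w ≡ true → B₂[ w ] w′ ≡ true → B₂[ v ] w′ ≡ true
    B₂-trans-X {v} {w} {w′} Xv Xw Xw′ vw ww′ with B₂[ v ] w′ in vw′
    ... | true  = refl
    ... | false =
      contradiction (+-cancelˡ-≤ (suc d) (suc d) 3 counting) (≤⇒≯ (≤-trans (m≤m+n 3 3) 6≤d))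
      where
      N[v]∩N[w′]=∅ : ∀ y → N[ v ] y ≡ true → N[ w′ ] y ≡ true → ⊥
      N[v]∩N[w′]=∅ y vy w′y with () ← ≡.trans (≡.sym vw′)
        (within₂⁺ G (within₁⁻ G vy) (near-sym G (within₁⁻ G w′y)))

      counting : suc d + suc d ≤ suc d + 3
      counting = begin
        suc d + suc d                ≡⟨ ≡.cong₂ _+_ (closedNbhd-size v) (closedNbhd-size w′) ⟨
        count N[ v ] + count N[ w′ ] ≤⟨ count-disjoint-∪ N[v]∩N[w′]=∅
                                           (λ _ → B₂-absorbs-N Xw Xv (within₂-sym G vw))
                                           (λ _ → B₂-absorbs-N Xw Xw′ ww′) ⟩
        count B₂[ w ]                ≤⟨ ball₂-size-X Xw ⟩
        d + 4                        ≡⟨ +-suc d 3 ⟩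
        suc d + 3                    ∎
        where open ≤-Reasoning

    ∼⇒B₂ : ∀ {u w} → _∼_ G u w → B₂[ u ] w ≡ true
    ∼⇒B₂ {u} (here _)       = within-refl G 2 u
    ∼⇒B₂ (step Xu uv v∼w) with Xv , Xw ← ∼-endpoints G v∼w = B₂-trans-X Xu Xv Xw uv (∼⇒B₂ v∼w)

    region⊆B₂ : ∀ {u v y} → InX G v → InRegion G u v → InRegion G u y → B₂[ v ] y ≡ true
    region⊆B₂ Xv (w′ , u∼w′ , w′v) (w , u∼w , wy)
      with _ , Xw ← ∼-endpoints G u∼w | _ , Xw′ ← ∼-endpoints G u∼w′ =
      B₂-absorbs-N Xv Xw (within₂-sym G (B₂-absorbs-N Xw Xw′ ww′ (within₁⁺ G w′v))) (within₁⁺ G wy)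
      where
      ww′ : B₂[ w ] w′ ≡ true
      ww′ = ∼⇒B₂ (∼-trans G (∼-sym G u∼w) u∼w′)

    region-size≤ball₂ : ∀ {u x} ys → InX G x → InRegion G u x →
                        Unique ys → All (InRegion G u) ys → length ys ≤ suc d + deg2 G x
    region-size≤ball₂ {x = x} ys Xx ux uniq inR =
      ≤-trans (Unique⇒length≤count uniq (All.map (region⊆B₂ Xx ux) inR)) (ball₂-size x)

    region-size≤d+4 : ∀ {u} ys → InX G u → Unique ys → All (InRegion G u) ys → length ys ≤ d + 4
    region-size≤d+4 {u} ys Xu uniq inR =
      ≤-trans (region-size≤ball₂ ys Xu (u , here Xu , inj₁ refl) uniq inR) (deg₂-bound-X {u} Xu)

    region-size≤d+deg₂+1 : ∀ {u x} ys → InX G u → InRegion G u x →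
                           Unique ys → All (InRegion G u) ys → length ys ≤ d + deg2 G x + 1
    region-size≤d+deg₂+1 {x = x} ys Xu ux uniq inR with deg2 G x <? 4
    ... | yes Xx = ≤-trans (region-size≤ball₂ ys Xx ux uniq inR)
                           (≤-reflexive (+-comm 1 (d + deg2 G x)))
    ... | no ¬Xx = ≤-trans (region-size≤d+4 ys Xu uniq inR)
                           (≤-trans (+-monoʳ-≤ d (≮⇒≥ ¬Xx)) (m≤m+n (d + deg2 G x) 1))

  closedNbhd⊆region : ∀ {u} → InX G u →
    Σ (List (Fin n)) λ ys → Unique ys × All (InRegion G u) ys × d + 1 ≤ length ys
  closedNbhd⊆region {u} Xu with ys , uniq , uys , |ys| ← count-witness N[ u ] =
    ys , uniq , All.map (λ uy → u , here Xu , within₁⁻ G uy) uys ,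
    ≤-reflexive (≡.trans (+-comm d 1) (≡.sym (≡.trans |ys| (closedNbhd-size u))))

lemma3p2 : ∀ {n : ℕ} (G : Graph n) (d : ℕ) → 6 < d → Regular G d → ¬ SquareComplete G →
    ∀ (u : Fin n) → InX G u → ∀ (v : Fin n) → InX G v → InRegion G u v →
      (Σ (List (Fin n)) (λ ys → Unique ys × All (InRegion G u) ys × (d + 1 ≤ length ys)))
      × (∀ y → InRegion G u y → within G 2 v y ≡ true)
      × (∀ x → InRegion G u x → ∀ (ys : List (Fin n)) → Unique ys → All (InRegion G u) ys →
           length ys ≤ d + deg2 G x + 1)
      × (∀ (ys : List (Fin n)) → Unique ys → All (InRegion G u) ys → length ys ≤ d + 4)
      × (∀ (u' : Fin n) → InX G u' → ¬ (∀ y → InRegion G u y ⇔ InRegion G u' y) →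
           ∀ y → ¬ (InRegion G u y × InRegion G u' y))
lemma3p2 G d 6<d regular _ u Xu v Xv uv =
    closedNbhd⊆region Xu
  , (λ y → region⊆B₂ 6≤d Xv uv)
  , (λ x ux ys → region-size≤d+deg₂+1 6≤d ys Xu ux)
  , (λ ys → region-size≤d+4 6≤d ys Xu)
  , (λ _ _ → regions-disjoint G)
  where
  open RegularGraph G regular
  6≤d : 6 ≤ d
  6≤d = <⇒≤ 6<d
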